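{- The one-step relation $\succ^{\mathit{sub}}_1$ induced by $\succ^{\mathit{sub}}$ is effectively finitely branching: for every $\mathcal{EL}$ GCI $\beta$, the set $\{\gamma\mid\beta\succ^{\mathit{sub}}_1\gamma\}$ is finite up to equivalence of the right-hand sides and (representatives of it) can effectively be computed.
   Context: $\mathcal{EL}$ concepts: $C::=A\mid\top\mid C\sqcap C\mid\exists r.C$; a GCI $C\sqsubseteq D$ is satisfied by an interpretation $\mathcal{I}$ iff $C^\mathcal{I}\subseteq D^\mathcal{I}$ (with $\top^\mathcal{I}=\Delta^\mathcal{I}$, $\sqcap$ as intersection, $(\exists r.C)^\mathcal{I}=\{d\mid\exists e\in C^\mathcal{I},(d,e)\in r^\mathcal{I}\}$). $\mathfrak{O}\models\alpha$ iff every model of $\mathfrak{O}$ satisfies $\alpha$; $C\sqsubseteq^\emptyset D$ iff $\emptyset\models C\sqsubseteq D$; $C\equiv^\emptyset D$ iff both $C\sqsubseteq^\emptyset D$ and $D\sqsubseteq^\emptyset C$. On GCIs, $C\sqsubseteq D\succ^{\mathit{sub}}C'\sqsubseteq D'$ iff $C'=C$, $D\sqsubseteq^\emptyset D'$ and $\{C\sqsubseteq D'\}\not\models C\sqsubseteq D$. The one-step relation is $\succ^{\mathit{sub}}_1=\{(\beta,\gamma)\in\succ^{\mathit{sub}}\mid$ no $\delta$ with $\beta\succ^{\mathit{sub}}\delta\succ^{\mathit{sub}}\gamma\}$. -}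

module Defs where

open import Data.Nat using (ℕ)
open import Data.List using (List; []; _∷_)
open import Data.List.Membership.Propositional using (_∈_)
open import Data.Product using (Σ; _×_)
open import Relation.Binary.PropositionalEquality using (_≡_)
open import Relation.Nullary using (¬_)

ConceptName : Set
ConceptName = ℕ

RoleName : Set
RoleName = ℕ

data Concept : Set where
  atom : ConceptName → Concept
  top  : Concept
  _⊓_  : Concept → Concept → Concept
  ex   : RoleName → Concept → Concept

record GCI : Set where
  constructor _⊑_
  field
    lhs : Concept
    rhs : Concept
open GCI public

record Interpretation : Set₁ where
  field
    Δ     : Set
    point : Δ
    conc  : ConceptName → Δ → Set
    role  : RoleName → Δ → Δ → Set

module _ (I : Interpretation) where
  open Interpretation I

  ext : Concept → Δ → Set
  ext (atom A) d = conc A d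
  ext top      d = Data.Unit.⊤
    where import Data.Unit
  ext (C ⊓ D)  d = ext C d × ext D d
  ext (ex r C) d = Σ Δ (λ e → ext C e × role r d e)

  Sat : GCI → Set
  Sat (C ⊑ D) = ∀ d → ext C d → ext D d

Ontology : Set
Ontology = List GCI

_isModelOf_ : Interpretation → Ontology → Set
I isModelOf O = ∀ α → α ∈ O → Sat I α

_⊨_ : Ontology → GCI → Set₁
O ⊨ α = ∀ (I : Interpretation) → I isModelOf O → Sat I α

_⊑∅_ : Concept → Concept → Set₁
C ⊑∅ D = [] ⊨ (C ⊑ D)

_≡∅_ : Concept → Concept → Set₁
C ≡∅ D = (C ⊑∅ D) × (D ⊑∅ C)

_≻sub_ : GCI → GCI → Set₁
β ≻sub γ = (lhs γ ≡ lhs β) × (rhs β ⊑∅ rhs γ) × ¬ (((lhs β ⊑ rhs γ) ∷ []) ⊨ β)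

_≻sub₁_ : GCI → GCI → Set₁
β ≻sub₁ γ = (β ≻sub γ) × ¬ Σ GCI (λ δ → (β ≻sub δ) × (δ ≻sub γ))

-- "effectively finitely branching up to equivalence of right-hand sides":
-- a (total, hence computable) function listing, for every β, finitely many
-- one-step successors such that every one-step successor has a
-- right-hand side equivalent to that of a listed one.
EffectivelyFinitelyBranching : (GCI → GCI → Set₁) → Set₁
EffectivelyFinitelyBranching R =
  Σ (GCI → List GCI) λ succs →
    ∀ β → (∀ γ → γ ∈ succs β → R β γ)
        × (∀ γ → R β γ → Σ GCI (λ γ' → (γ' ∈ succs β) × (rhs γ ≡∅ rhs γ')))

-- Subsumption w.r.t. the empty ontology is structural: in the interpretation whose elements are
-- concepts, D is an instance of exactly its subsumers, so D ⊑ A iff A is a conjunct of D, and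
-- D ⊑ ∃r.C iff some conjunct ∃r.E of D has E ⊑ C. Hence every subsumer of D is equivalent to a
-- conjunction of "prime" subsumers (the atoms of D, and ∃r.F for F a subsumer of a conjunct ∃r.E),
-- so up to equivalence D has finitely many subsumers, computed recursively. As β ≻sub δ and
-- δ ≻sub γ depend on rhs δ only up to equivalence, both the one-step successors of β and the GCIs
-- lying strictly between them may be sought among these representatives. What remains is deciding
-- the entailments inside ≻sub, done by EL completion: saturate the derivable subsumptions between
-- the finitely many subconcepts of the query and the ontology, and refute the underivable ones in
-- the canonical model of the saturated set.

module Submission where

open import Defs
open import Data.Bool using (true; false)
open import Data.Fin using (Fin; combine; remQuot)
open import Data.Fin.Properties using (any?; remQuot-combine) renaming (_≟_ to _≟ᶠ_)
open import Data.Fin.Subset using (Subset; ⁅_⁆; _∪_; _⊂_; _⊃_)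
  renaming (⊥ to ∅; _∈_ to _∈ˢ_; _∉_ to _∉ˢ_)
open import Data.Fin.Subset.Properties
  using (∉⊥; x∈⁅x⁆; x∈⁅y⁆⇒x≡y; p⊆p∪q; x∈p∪q⁺; x∈p∪q⁻)
  renaming (_∈?_ to _∈ˢ?_)
open import Data.Fin.Subset.Induction using (⊃-wellFounded)
open import Data.List using (List; []; _∷_; [_]; _++_; map; filter; foldr; concatMap; length; lookup)
open import Data.List.Membership.Propositional using (_∈_; find; lose)
open import Data.List.Membership.Propositional.Properties
  using ( ∈-map⁺; ∈-map⁻; ∈-++⁺ˡ; ∈-++⁺ʳ; ∈-++⁻; ∈-filter⁺; ∈-filter⁻
        ; ∈-concatMap⁺; ∈-concatMap⁻; ∈-lookup)
open import Data.List.Relation.Binary.Subset.Propositional using (_⊆_)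
open import Data.List.Relation.Unary.All using (All; []; _∷_; tabulate)
import Data.List.Relation.Unary.All.Properties as All
open import Data.List.Relation.Unary.Any using (Any; here; there; index; satisfied)
import Data.List.Relation.Unary.Any as Any
open import Data.List.Relation.Unary.Any.Properties using (lookup-index)
import Data.Nat as ℕ
open ℕ using (ℕ; _*_)
open import Data.Product using (Σ; Σ-syntax; ∃-syntax; _×_; _,_; proj₁; proj₂; uncurry)
open import Data.Sum using (inj₁; inj₂; [_,_]′)
open import Data.Unit using (tt)
open import Data.Empty using (⊥-elim)
open import Function using (_∘_; id)
open import Induction.WellFounded using (Acc; acc)
import Level
open import Relation.Binary.Bundles using (Setoid)
import Relation.Binary.Reasoning.Setoid
open import Relation.Binary.Definitions using (DecidableEquality)
open import Relation.Binary.PropositionalEquality using (_≡_; refl; sym; trans; cong; cong₂; subst)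
open import Relation.Nullary using (¬_; Dec; yes; no; does)
open import Relation.Nullary.Decidable using (map′; ¬?; _×-dec_; _⊎-dec_; decidable-stable)
open import Relation.Unary using (Pred; Decidable)

infix 4 _≟_

_≟_ : DecidableEquality Concept
atom A ≟ atom B with A ℕ.≟ B
... | yes refl = yes refl
... | no A≢B   = no λ { refl → A≢B refl }
top ≟ top = yes refl
(C ⊓ D) ≟ (C′ ⊓ D′) with C ≟ C′ | D ≟ D′
... | yes refl | yes refl = yes refl
... | no C≢C′  | _        = no λ { refl → C≢C′ refl }
... | yes _    | no D≢D′  = no λ { refl → D≢D′ refl }
ex r C ≟ ex s D with r ℕ.≟ s | C ≟ D
... | yes refl | yes refl = yes refl
... | no r≢s   | _        = no λ { refl → r≢s refl }
... | yes _    | no C≢D   = no λ { refl → C≢D refl }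
atom _  ≟ top     = no λ ()
atom _  ≟ (_ ⊓ _) = no λ ()
atom _  ≟ ex _ _  = no λ ()
top     ≟ atom _  = no λ ()
top     ≟ (_ ⊓ _) = no λ ()
top     ≟ ex _ _  = no λ ()
(_ ⊓ _) ≟ atom _  = no λ ()
(_ ⊓ _) ≟ top     = no λ ()
(_ ⊓ _) ≟ ex _ _  = no λ ()
ex _ _  ≟ atom _  = no λ ()
ex _ _  ≟ top     = no λ ()
ex _ _  ≟ (_ ⊓ _) = no λ ()

open import Data.List.Membership.DecPropositional _≟_ using (_∈?_)

ext-subst : ∀ {I C D d} → C ≡ D → ext I C d → ext I D d
ext-subst refl x = x

⊨∅ : ∀ {I} → I isModelOf []
⊨∅ _ ()

-- ext is not injective, so Agda cannot recover C and D from the type C ⊑∅ D; this is why many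
-- implicit concept arguments below are supplied by hand.

⊑∅-refl : ∀ {C} → C ⊑∅ C
⊑∅-refl _ _ _ = id

⊑∅-trans : ∀ {C D E} → C ⊑∅ D → D ⊑∅ E → C ⊑∅ E
⊑∅-trans C⊑D D⊑E I I⊨∅ d = D⊑E I I⊨∅ d ∘ C⊑D I I⊨∅ d

≡∅-sym : ∀ {C D} → C ≡∅ D → D ≡∅ C
≡∅-sym (C⊑D , D⊑C) = D⊑C , C⊑D

≡∅-trans : ∀ {C D E} → C ≡∅ D → D ≡∅ E → C ≡∅ E
≡∅-trans {C} {D} {E} (C⊑D , D⊑C) (D⊑E , E⊑D) =
  ⊑∅-trans {C} {D} {E} C⊑D D⊑E , ⊑∅-trans {E} {D} {C} E⊑D D⊑C

ex-mono : ∀ {C D} r → C ⊑∅ D → ex r C ⊑∅ ex r D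
ex-mono r C⊑D I I⊨∅ d (e , e∈C , de) = e , C⊑D I I⊨∅ e e∈C , de

ex-cong : ∀ {C D} r → C ≡∅ D → ex r C ≡∅ ex r D
ex-cong {C} {D} r (C⊑D , D⊑C) = ex-mono {C} {D} r C⊑D , ex-mono {D} {C} r D⊑C

⊨-⊑∅-trans : ∀ {O C D E} → O ⊨ (C ⊑ D) → D ⊑∅ E → O ⊨ (C ⊑ E)
⊨-⊑∅-trans O⊨C⊑D D⊑E I I⊨O d = D⊑E I ⊨∅ d ∘ O⊨C⊑D I I⊨O d

⊨-strengthen-axiom : ∀ {C E F} α → E ⊑∅ F → ((C ⊑ F) ∷ []) ⊨ α → ((C ⊑ E) ∷ []) ⊨ α
⊨-strengthen-axiom α E⊑F ⊨α I I⊨C⊑E =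
  ⊨α I λ { _ (here refl) d → E⊑F I ⊨∅ d ∘ I⊨C⊑E _ (here refl) d }

≡∅-setoid : Setoid Level.zero (Level.suc Level.zero)
≡∅-setoid = record
  { Carrier       = Concept
  ; _≈_           = _≡∅_
  ; isEquivalence = record
    { refl  = λ {C} → ⊑∅-refl {C} , ⊑∅-refl {C}
    ; sym   = λ {C D} → ≡∅-sym {C} {D}
    ; trans = λ {C D E} → ≡∅-trans {C} {D} {E}
    }
  }

module ≡∅-Reasoning = Relation.Binary.Reasoning.Setoid ≡∅-setoid

⨅ : List Concept → Concept
⨅ = foldr _⊓_ top

module _ {I : Interpretation} {d : Interpretation.Δ I} where

  ⨅⁺ : ∀ Cs → All (λ C → ext I C d) Cs → ext I (⨅ Cs) d
  ⨅⁺ []       []       = tt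
  ⨅⁺ (C ∷ Cs) (x ∷ xs) = x , ⨅⁺ Cs xs

  ⨅⁻ : ∀ Cs → ext I (⨅ Cs) d → All (λ C → ext I C d) Cs
  ⨅⁻ []       tt       = []
  ⨅⁻ (C ∷ Cs) (x , xs) = x ∷ ⨅⁻ Cs xs

⨅-antitone : ∀ {Cs Ds} → Cs ⊆ Ds → ⨅ Ds ⊑∅ ⨅ Cs
⨅-antitone {Cs} {Ds} Cs⊆Ds I _ d = ⨅⁺ Cs ∘ All.anti-mono Cs⊆Ds ∘ ⨅⁻ Ds

⨅-greatest : ∀ {D} Cs → (∀ {C} → C ∈ Cs → D ⊑∅ C) → D ⊑∅ ⨅ Cs
⨅-greatest Cs D⊑Cs I I⊨∅ d x = ⨅⁺ Cs (tabulate λ C∈Cs → D⊑Cs C∈Cs I I⊨∅ d x)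

⨅-++ : ∀ Cs Ds → ⨅ (Cs ++ Ds) ≡∅ (⨅ Cs ⊓ ⨅ Ds)
⨅-++ Cs Ds =
  (λ I _ d x → let x∈all = ⨅⁻ (Cs ++ Ds) x in ⨅⁺ Cs (All.++⁻ˡ Cs x∈all) , ⨅⁺ Ds (All.++⁻ʳ Cs x∈all)) ,
  (λ I _ d (x , y) → ⨅⁺ (Cs ++ Ds) (All.++⁺ (⨅⁻ Cs x) (⨅⁻ Ds y)))

⨅-[_] : ∀ C → C ≡∅ ⨅ [ C ]
⨅-[ C ] = (λ _ _ _ x → x , tt) , (λ _ _ _ → proj₁)

⊓-cong : ∀ {C C′ D D′} → C ≡∅ C′ → D ≡∅ D′ → (C ⊓ D) ≡∅ (C′ ⊓ D′)
⊓-cong (C⊑C′ , C′⊑C) (D⊑D′ , D′⊑D) =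
  (λ I I⊨∅ d (x , y) → C⊑C′ I I⊨∅ d x , D⊑D′ I I⊨∅ d y) ,
  (λ I I⊨∅ d (x , y) → C′⊑C I I⊨∅ d x , D′⊑D I I⊨∅ d y)

module _ {a} {A : Set a} where

  sublists : List A → List (List A)
  sublists []       = [ [] ]
  sublists (x ∷ xs) = map (x ∷_) (sublists xs) ++ sublists xs

  sublists-⊆ : ∀ xs {ys} → ys ∈ sublists xs → ys ⊆ xs
  sublists-⊆ [] (here refl) ()
  sublists-⊆ (x ∷ xs) ys∈ with ∈-++⁻ (map (x ∷_) (sublists xs)) ys∈
  ... | inj₂ ys∈′ = there ∘ sublists-⊆ xs ys∈′
  ... | inj₁ x∷zs∈ with ∈-map⁻ (x ∷_) x∷zs∈
  ...   | zs , zs∈ , refl = λ { (here refl) → here refl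
                              ; (there z∈)  → there (sublists-⊆ xs zs∈ z∈) }

  filter∈sublists : ∀ {p} {P : Pred A p} (P? : Decidable P) xs → filter P? xs ∈ sublists xs
  filter∈sublists P? [] = here refl
  filter∈sublists P? (x ∷ xs) with does (P? x)
  ... | true  = ∈-++⁺ˡ (∈-map⁺ (x ∷_) (filter∈sublists P? xs))
  ... | false = ∈-++⁺ʳ (map (x ∷_) (sublists xs)) (filter∈sublists P? xs)

⨅-≡∅-sublist : ∀ {Cs Ds} → Cs ⊆ Ds →
               Σ (List Concept) λ Es → Es ∈ sublists Ds × ⨅ Cs ≡∅ ⨅ Es
⨅-≡∅-sublist {Cs} {Ds} Cs⊆Ds =
  filter (_∈? Cs) Ds , filter∈sublists (_∈? Cs) Ds ,
  ⨅-antitone {filter (_∈? Cs) Ds} {Cs} (proj₂ ∘ ∈-filter⁻ (_∈? Cs) {xs = Ds}) ,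
  ⨅-antitone {Cs} {filter (_∈? Cs) Ds} λ C∈Cs → ∈-filter⁺ (_∈? Cs) (Cs⊆Ds C∈Cs) C∈Cs

-- Subsumers w.r.t. the empty ontology

conjuncts : Concept → List Concept
conjuncts (atom A) = [ atom A ]
conjuncts top      = []
conjuncts (C ⊓ D)  = conjuncts C ++ conjuncts D
conjuncts (ex r C) = [ ex r C ]

syntactic : Interpretation
syntactic = record
  { Δ     = Concept
  ; point = top
  ; conc  = λ A C → atom A ∈ conjuncts C
  ; role  = λ r C D → ex r D ∈ conjuncts C
  }

conjuncts-⊆⇒ext : ∀ C {D} → conjuncts C ⊆ conjuncts D → ext syntactic C D
conjuncts-⊆⇒ext (atom A) C⊆D = C⊆D (here refl)
conjuncts-⊆⇒ext top      C⊆D = tt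
conjuncts-⊆⇒ext (C ⊓ C′) C⊆D =
  conjuncts-⊆⇒ext C (C⊆D ∘ ∈-++⁺ˡ) , conjuncts-⊆⇒ext C′ (C⊆D ∘ ∈-++⁺ʳ (conjuncts C))
conjuncts-⊆⇒ext (ex r C) C⊆D = C , conjuncts-⊆⇒ext C id , C⊆D (here refl)

ext-syntactic-self : ∀ C → ext syntactic C C
ext-syntactic-self C = conjuncts-⊆⇒ext C id

conjunct⇒⊑∅ : ∀ D {C} → C ∈ conjuncts D → D ⊑∅ C
conjunct⇒⊑∅ (atom A) (here refl) _ _ _ = id
conjunct⇒⊑∅ (ex r C) (here refl) _ _ _ = id
conjunct⇒⊑∅ (D ⊓ D′) C∈ I I⊨∅ d (x , y) with ∈-++⁻ (conjuncts D) C∈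
... | inj₁ C∈D  = conjunct⇒⊑∅ D C∈D I I⊨∅ d x
... | inj₂ C∈D′ = conjunct⇒⊑∅ D′ C∈D′ I I⊨∅ d y

ext-syntactic⇒⊑∅ : ∀ C {D} → ext syntactic C D → D ⊑∅ C
ext-syntactic⇒⊑∅ (atom A) {D} A∈D = conjunct⇒⊑∅ D A∈D
ext-syntactic⇒⊑∅ top      _       _ _ _ _ = tt
ext-syntactic⇒⊑∅ (C ⊓ C′) (x , y) I I⊨∅ d z =
  ext-syntactic⇒⊑∅ C x I I⊨∅ d z , ext-syntactic⇒⊑∅ C′ y I I⊨∅ d z
ext-syntactic⇒⊑∅ (ex r C) {D} (E , E∈C , ∃rE∈D) =
  ⊑∅-trans {D} {ex r E} {ex r C} (conjunct⇒⊑∅ D ∃rE∈D)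
                                  (ex-mono {E} {C} r (ext-syntactic⇒⊑∅ C E∈C))

⊑∅-atom⇒conjunct : ∀ D {A} → D ⊑∅ atom A → atom A ∈ conjuncts D
⊑∅-atom⇒conjunct D D⊑A = D⊑A syntactic ⊨∅ D (ext-syntactic-self D)

⊑∅-ex⇒conjunct : ∀ D {r C} → D ⊑∅ ex r C → Σ Concept λ E → ex r E ∈ conjuncts D × E ⊑∅ C
⊑∅-ex⇒conjunct D {C = C} D⊑∃rC with D⊑∃rC syntactic ⊨∅ D (ext-syntactic-self D)
... | E , E∈C , ∃rE∈D = E , ∃rE∈D , ext-syntactic⇒⊑∅ C E∈C

mutual
  primeSubsumers : Concept → List Concept
  primeSubsumers (atom A) = [ atom A ]
  primeSubsumers top      = []
  primeSubsumers (C ⊓ D)  = primeSubsumers C ++ primeSubsumers D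
  primeSubsumers (ex r C) = map (ex r) (subsumers C)

  subsumers : Concept → List Concept
  subsumers C = map ⨅ (sublists (primeSubsumers C))

atom∈primeSubsumers : ∀ D {A} → atom A ∈ conjuncts D → atom A ∈ primeSubsumers D
atom∈primeSubsumers (atom _) (here refl) = here refl
atom∈primeSubsumers (D ⊓ D′) A∈ with ∈-++⁻ (conjuncts D) A∈
... | inj₁ A∈D  = ∈-++⁺ˡ (atom∈primeSubsumers D A∈D)
... | inj₂ A∈D′ = ∈-++⁺ʳ (primeSubsumers D) (atom∈primeSubsumers D′ A∈D′)
atom∈primeSubsumers (ex _ _) (here ())

ex∈primeSubsumers : ∀ D {r C E} → ex r C ∈ conjuncts D → E ∈ subsumers C →
                    ex r E ∈ primeSubsumers D
ex∈primeSubsumers (ex r C) (here refl) E∈ = ∈-map⁺ (ex r) E∈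
ex∈primeSubsumers (D ⊓ D′) ∃rC∈ E∈ with ∈-++⁻ (conjuncts D) ∃rC∈
... | inj₁ ∃rC∈D  = ∈-++⁺ˡ (ex∈primeSubsumers D ∃rC∈D E∈)
... | inj₂ ∃rC∈D′ = ∈-++⁺ʳ (primeSubsumers D) (ex∈primeSubsumers D′ ∃rC∈D′ E∈)
ex∈primeSubsumers (atom _) (here ()) _

mutual
  primeSubsumers-sound : ∀ D {C} → C ∈ primeSubsumers D → D ⊑∅ C
  primeSubsumers-sound (atom A) (here refl) = ⊑∅-refl {atom A}
  primeSubsumers-sound (D ⊓ D′) C∈ I I⊨∅ d (x , y) with ∈-++⁻ (primeSubsumers D) C∈
  ... | inj₁ C∈D  = primeSubsumers-sound D C∈D I I⊨∅ d x
  ... | inj₂ C∈D′ = primeSubsumers-sound D′ C∈D′ I I⊨∅ d y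
  primeSubsumers-sound (ex r C) ∃rE∈ with ∈-map⁻ (ex r) ∃rE∈
  ... | E , E∈ , refl = ex-mono {C} {E} r (subsumers-sound C E∈)

  subsumers-sound : ∀ D {C} → C ∈ subsumers D → D ⊑∅ C
  subsumers-sound D C∈ with ∈-map⁻ ⨅ C∈
  ... | Cs , Cs∈ , refl = ⨅-greatest {D} Cs (primeSubsumers-sound D ∘ sublists-⊆ _ Cs∈)

mutual
  ⊑∅⇒≡∅⨅-primeSubsumers : ∀ D C → D ⊑∅ C →
                           Σ (List Concept) λ Cs → Cs ⊆ primeSubsumers D × C ≡∅ ⨅ Cs
  ⊑∅⇒≡∅⨅-primeSubsumers D (atom A) D⊑A =
    [ atom A ] ,
    (λ { (here refl) → atom∈primeSubsumers D (⊑∅-atom⇒conjunct D {A} D⊑A) }) ,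
    ⨅-[ atom A ]
  ⊑∅⇒≡∅⨅-primeSubsumers D top _ = [] , (λ ()) , ⊑∅-refl {top} , ⊑∅-refl {top}
  ⊑∅⇒≡∅⨅-primeSubsumers D (C ⊓ C′) D⊑C⊓C′
    with ⊑∅⇒≡∅⨅-primeSubsumers D C (λ I I⊨∅ d → proj₁ ∘ D⊑C⊓C′ I I⊨∅ d)
       | ⊑∅⇒≡∅⨅-primeSubsumers D C′ (λ I I⊨∅ d → proj₂ ∘ D⊑C⊓C′ I I⊨∅ d)
  ... | Cs , Cs⊆ , C≡ | Cs′ , Cs′⊆ , C′≡ = Cs ++ Cs′ , [ Cs⊆ , Cs′⊆ ]′ ∘ ∈-++⁻ Cs , C⊓C′≡
    where
    open ≡∅-Reasoning
    C⊓C′≡ : (C ⊓ C′) ≡∅ ⨅ (Cs ++ Cs′)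
    C⊓C′≡ = begin
      C ⊓ C′          ≈⟨ ⊓-cong {C} {⨅ Cs} {C′} {⨅ Cs′} C≡ C′≡ ⟩
      ⨅ Cs ⊓ ⨅ Cs′    ≈⟨ ⨅-++ Cs Cs′ ⟨
      ⨅ (Cs ++ Cs′)   ∎
  ⊑∅⇒≡∅⨅-primeSubsumers D (ex r C) D⊑∃rC with ⊑∅-ex⇒conjunct D {r} {C} D⊑∃rC
  ... | E , ∃rE∈D , E⊑C with subsumers-complete E C E⊑C
  ... | F , F∈ , C≡F = [ ex r F ] , (λ { (here refl) → ex∈primeSubsumers D ∃rE∈D F∈ }) , ∃rC≡
    where
    open ≡∅-Reasoning
    ∃rC≡ : ex r C ≡∅ ⨅ [ ex r F ]
    ∃rC≡ = begin
      ex r C          ≈⟨ ex-cong {C} {F} r C≡F ⟩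
      ex r F          ≈⟨ ⨅-[ ex r F ] ⟩
      ⨅ [ ex r F ]    ∎

  subsumers-complete : ∀ D C → D ⊑∅ C → Σ Concept λ F → F ∈ subsumers D × C ≡∅ F
  subsumers-complete D C D⊑C with ⊑∅⇒≡∅⨅-primeSubsumers D C D⊑C
  ... | Cs , Cs⊆ , C≡⨅Cs with ⨅-≡∅-sublist Cs⊆
  ...   | Es , Es∈ , ⨅Cs≡⨅Es =
    ⨅ Es , ∈-map⁺ ⨅ Es∈ , ≡∅-trans {C} {⨅ Cs} {⨅ Es} C≡⨅Cs ⨅Cs≡⨅Es

-- Deciding entailment by completion

p⊂p∪⁅x⁆ : ∀ {m} {p : Subset m} {x} → x ∉ˢ p → p ⊂ p ∪ ⁅ x ⁆
p⊂p∪⁅x⁆ {x = x} x∉p = p⊆p∪q ⁅ x ⁆ , x , x∈p∪q⁺ (inj₂ (x∈⁅x⁆ x)) , x∉p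

module Saturation {m : ℕ} (Step : Subset m → Fin m → Set) (step? : ∀ p i → Dec (Step p i)) where

  Closed : Subset m → Set
  Closed p = ∀ {i} → Step p i → i ∈ˢ p

  saturate : ∀ {ℓ} (Invariant : Subset m → Set ℓ) →
             (∀ {p i} → Invariant p → Step p i → Invariant (p ∪ ⁅ i ⁆)) →
             ∀ {p} → Invariant p → Σ (Subset m) λ q → Invariant q × Closed q
  saturate Invariant step-preserves {p} = go (⊃-wellFounded p)
    where
    go : ∀ {p} → Acc _⊃_ p → Invariant p → Σ (Subset m) λ q → Invariant q × Closed q
    go {p} (acc larger) inv with any? (λ i → step? p i ×-dec ¬? (i ∈ˢ? p))
    ... | yes (i , st , i∉p) = go (larger (p⊂p∪⁅x⁆ i∉p)) (step-preserves inv st)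
    ... | no stuck = p , inv , λ {i} st → decidable-stable (i ∈ˢ? p) λ i∉p → stuck (i , st , i∉p)

ex-same-role? : ∀ C D E F → Dec (∃[ r ] C ≡ ex r D × E ≡ ex r F)
ex-same-role? (ex r C) D E F =
  map′ (λ (C≡D , E≡) → r , cong (ex r) C≡D , E≡) (λ { (_ , refl , E≡) → refl , E≡ })
       (C ≟ D ×-dec E ≟ ex r F)
ex-same-role? (atom _) _ _ _ = no λ { (_ , () , _) }
ex-same-role? top      _ _ _ = no λ { (_ , () , _) }
ex-same-role? (_ ⊓ _)  _ _ _ = no λ { (_ , () , _) }

module Completion
  (O : Ontology) (U : List Concept)
  (⊓-closed : ∀ {C D} → C ⊓ D ∈ U → C ∈ U × D ∈ U)
  (ex-closed : ∀ {r C} → ex r C ∈ U → C ∈ U)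
  (axioms-closed : ∀ {α} → α ∈ O → lhs α ∈ U × rhs α ∈ U)
  where

  n : ℕ
  n = length U

  u : Fin n → Concept
  u = lookup U

  index-of : ∀ {C} → C ∈ U → Σ (Fin n) λ K → u K ≡ C
  index-of C∈U = index C∈U , sym (lookup-index C∈U)

  ⊓-indices : ∀ {K C D} → u K ≡ C ⊓ D →
              Σ[ K₁ ∈ Fin n ] Σ[ K₂ ∈ Fin n ] u K₁ ≡ C × u K₂ ≡ D × u K ≡ u K₁ ⊓ u K₂
  ⊓-indices {K} K≡ with ⊓-closed (subst (_∈ U) K≡ (∈-lookup K))
  ... | C∈U , D∈U with index-of C∈U | index-of D∈U
  ...   | K₁ , K₁≡ | K₂ , K₂≡ = K₁ , K₂ , K₁≡ , K₂≡ , trans K≡ (cong₂ _⊓_ (sym K₁≡) (sym K₂≡))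

  ex-index : ∀ {K r C} → u K ≡ ex r C → Σ[ K′ ∈ Fin n ] u K′ ≡ C × u K ≡ ex r (u K′)
  ex-index {K} {r} K≡ with index-of (ex-closed (subst (_∈ U) K≡ (∈-lookup K)))
  ... | K′ , K′≡ = K′ , K′≡ , trans K≡ (cong (ex r) (sym K′≡))

  -- A fact is a pair of indices (X , Z), encoded by combine, standing for u X ⊑ u Z.
  Facts : Set
  Facts = Subset (n * n)

  Derived : Facts → Fin n → Fin n → Set
  Derived s X Z = combine X Z ∈ˢ s

  derived? : ∀ s X Z → Dec (Derived s X Z)
  derived? s X Z = combine X Z ∈ˢ? s

  -- ⊑-same is needed because U may list a concept at several indices.
  data Step (s : Facts) : Fin n → Fin n → Set where
    ⊑-refl  : ∀ {X} → Step s X X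
    ⊑-top   : ∀ {X Z} → u Z ≡ top → Step s X Z
    ⊑-same  : ∀ {X Z} W → Derived s X W → u W ≡ u Z → Step s X Z
    ⊓-intro : ∀ {X Z} W₁ W₂ → Derived s X W₁ → Derived s X W₂ → u Z ≡ u W₁ ⊓ u W₂ →
              Step s X Z
    ⊓-elimˡ : ∀ {X Z} W Z′ → Derived s X W → u W ≡ u Z ⊓ u Z′ → Step s X Z
    ⊓-elimʳ : ∀ {X Z} W Z′ → Derived s X W → u W ≡ u Z′ ⊓ u Z → Step s X Z
    ∃-mono  : ∀ {X Z r} W Y V → Derived s X W → u W ≡ ex r (u Y) →
              Derived s Y V → u Z ≡ ex r (u V) → Step s X Z
    axiom   : ∀ {X Z α} W → Derived s X W → α ∈ O → u W ≡ lhs α → u Z ≡ rhs α → Step s X Z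

  step? : ∀ s X Z → Dec (Step s X Z)
  step? s X Z = map′
    (λ { (inj₁ refl) → ⊑-refl
       ; (inj₂ (inj₁ Z≡⊤)) → ⊑-top Z≡⊤
       ; (inj₂ (inj₂ (inj₁ (W , XW , W≡Z)))) → ⊑-same W XW W≡Z
       ; (inj₂ (inj₂ (inj₂ (inj₁ (W₁ , W₂ , XW₁ , XW₂ , Z≡))))) → ⊓-intro W₁ W₂ XW₁ XW₂ Z≡
       ; (inj₂ (inj₂ (inj₂ (inj₂ (inj₁ (W , Z′ , XW , W≡)))))) → ⊓-elimˡ W Z′ XW W≡
       ; (inj₂ (inj₂ (inj₂ (inj₂ (inj₂ (inj₁ (W , Z′ , XW , W≡))))))) → ⊓-elimʳ W Z′ XW W≡
       ; (inj₂ (inj₂ (inj₂ (inj₂ (inj₂ (inj₂ (inj₁ (W , Y , V , XW , YV , r , W≡ , Z≡)))))))) →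
           ∃-mono {r = r} W Y V XW W≡ YV Z≡
       ; (inj₂ (inj₂ (inj₂ (inj₂ (inj₂ (inj₂ (inj₂ (W , XW , ax)))))))) →
           let _ , α∈O , W≡ , Z≡ = find ax in axiom W XW α∈O W≡ Z≡
       })
    (λ { ⊑-refl → inj₁ refl
       ; (⊑-top Z≡⊤) → inj₂ (inj₁ Z≡⊤)
       ; (⊑-same W XW W≡Z) → inj₂ (inj₂ (inj₁ (W , XW , W≡Z)))
       ; (⊓-intro W₁ W₂ XW₁ XW₂ Z≡) → inj₂ (inj₂ (inj₂ (inj₁ (W₁ , W₂ , XW₁ , XW₂ , Z≡))))
       ; (⊓-elimˡ W Z′ XW W≡) → inj₂ (inj₂ (inj₂ (inj₂ (inj₁ (W , Z′ , XW , W≡)))))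
       ; (⊓-elimʳ W Z′ XW W≡) → inj₂ (inj₂ (inj₂ (inj₂ (inj₂ (inj₁ (W , Z′ , XW , W≡))))))
       ; (∃-mono {r = r} W Y V XW W≡ YV Z≡) →
           inj₂ (inj₂ (inj₂ (inj₂ (inj₂ (inj₂ (inj₁ (W , Y , V , XW , YV , r , W≡ , Z≡)))))))
       ; (axiom W XW α∈O W≡ Z≡) →
           inj₂ (inj₂ (inj₂ (inj₂ (inj₂ (inj₂ (inj₂ (W , XW , lose α∈O (W≡ , Z≡))))))))
       })
    ( X ≟ᶠ Z
    ⊎-dec u Z ≟ top
    ⊎-dec any? (λ W → derived? s X W ×-dec u W ≟ u Z)
    ⊎-dec any? (λ W₁ → any? λ W₂ →
            derived? s X W₁ ×-dec derived? s X W₂ ×-dec u Z ≟ u W₁ ⊓ u W₂)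
    ⊎-dec any? (λ W → any? λ Z′ → derived? s X W ×-dec u W ≟ u Z ⊓ u Z′)
    ⊎-dec any? (λ W → any? λ Z′ → derived? s X W ×-dec u W ≟ u Z′ ⊓ u Z)
    ⊎-dec any? (λ W → any? λ Y → any? λ V →
            derived? s X W ×-dec derived? s Y V ×-dec ex-same-role? (u W) (u Y) (u Z) (u V))
    ⊎-dec any? (λ W → derived? s X W ×-dec Any.any? (λ α → u W ≟ lhs α ×-dec u Z ≟ rhs α) O))

  Sound : Facts → Set₁
  Sound s = ∀ {X Z} → Derived s X Z → O ⊨ (u X ⊑ u Z)

  step-sound : ∀ {s X Z} → Sound s → Step s X Z → O ⊨ (u X ⊑ u Z)
  step-sound sound ⊑-refl _ _ _ = id
  step-sound sound (⊑-top Z≡⊤) _ _ _ _ = ext-subst (sym Z≡⊤) tt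
  step-sound sound (⊑-same W XW W≡Z) I I⊨O d = ext-subst W≡Z ∘ sound XW I I⊨O d
  step-sound sound (⊓-intro W₁ W₂ XW₁ XW₂ Z≡) I I⊨O d x =
    ext-subst (sym Z≡) (sound XW₁ I I⊨O d x , sound XW₂ I I⊨O d x)
  step-sound sound (⊓-elimˡ W Z′ XW W≡) I I⊨O d = proj₁ ∘ ext-subst W≡ ∘ sound XW I I⊨O d
  step-sound sound (⊓-elimʳ W Z′ XW W≡) I I⊨O d = proj₂ ∘ ext-subst W≡ ∘ sound XW I I⊨O d
  step-sound sound (∃-mono W Y V XW W≡ YV Z≡) I I⊨O d x with ext-subst W≡ (sound XW I I⊨O d x)
  ... | e , e∈Y , de = ext-subst (sym Z≡) (e , sound YV I I⊨O e e∈Y , de)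
  step-sound sound (axiom W XW α∈O W≡ Z≡) I I⊨O d =
    ext-subst (sym Z≡) ∘ I⊨O _ α∈O d ∘ ext-subst W≡ ∘ sound XW I I⊨O d

  endpoints : Fin (n * n) → Fin n × Fin n
  endpoints = remQuot {n} n

  StepAt : Facts → Fin (n * n) → Set
  StepAt s i = uncurry (Step s) (endpoints i)

  open Saturation StepAt (λ s i → step? s (proj₁ (endpoints i)) (proj₂ (endpoints i)))

  insert-sound : ∀ {s i} → Sound s → StepAt s i → Sound (s ∪ ⁅ i ⁆)
  insert-sound {s} {i} sound st {X} {Z} XZ∈ with x∈p∪q⁻ s ⁅ i ⁆ XZ∈
  ... | inj₁ XZ∈s   = sound XZ∈s
  ... | inj₂ XZ∈⁅i⁆ = subst (λ (X , Z) → O ⊨ (u X ⊑ u Z)) i↦XZ (step-sound sound st)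
    where
    i↦XZ : endpoints i ≡ (X , Z)
    i↦XZ = trans (cong endpoints (sym (x∈⁅y⁆⇒x≡y i XZ∈⁅i⁆))) (remQuot-combine X Z)

  closed⇒derived : ∀ {s} → Closed s → ∀ {X Z} → Step s X Z → Derived s X Z
  closed⇒derived {s} closed {X} {Z} = closed ∘ subst (uncurry (Step s)) (sym (remQuot-combine X Z))

  saturation : Σ Facts λ s → Sound s × Closed s
  saturation = saturate Sound insert-sound {∅} (⊥-elim ∘ ∉⊥)

  module Canonical (s : Facts) (closed : Closed s) (X₀ : Fin n) where

    canonical : Interpretation
    canonical = record
      { Δ     = Fin n
      ; point = X₀
      ; conc  = λ A Y → Σ (Fin n) λ W → u W ≡ atom A × Derived s Y W
      ; role  = λ r Y V → Σ (Fin n) λ W → u W ≡ ex r (u V) × Derived s Y W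
      }

    derive : ∀ {X Z} → Step s X Z → Derived s X Z
    derive = closed⇒derived closed

    ext⇒derived : ∀ C {K} → u K ≡ C → ∀ {Y} → ext canonical C Y → Derived s Y K
    ext⇒derived (atom A) K≡ (W , W≡ , YW) = derive (⊑-same W YW (trans W≡ (sym K≡)))
    ext⇒derived top      K≡ _ = derive (⊑-top K≡)
    ext⇒derived (C ⊓ D)  K≡ (y∈C , y∈D) with ⊓-indices K≡
    ... | K₁ , K₂ , K₁≡ , K₂≡ , K≡K₁⊓K₂ =
      derive (⊓-intro K₁ K₂ (ext⇒derived C K₁≡ y∈C) (ext⇒derived D K₂≡ y∈D) K≡K₁⊓K₂)
    ext⇒derived (ex r C) K≡ (V , v∈C , W , W≡ , YW) with ex-index K≡
    ... | K′ , K′≡ , K≡∃rK′ = derive (∃-mono W V K′ YW W≡ (ext⇒derived C K′≡ v∈C) K≡∃rK′)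

    derived⇒ext : ∀ C {K} → u K ≡ C → ∀ {Y} → Derived s Y K → ext canonical C Y
    derived⇒ext (atom A) {K} K≡ YK = K , K≡ , YK
    derived⇒ext top      _ _ = tt
    derived⇒ext (C ⊓ D) {K} K≡ YK with ⊓-indices K≡
    ... | K₁ , K₂ , K₁≡ , K₂≡ , K≡K₁⊓K₂ =
      derived⇒ext C K₁≡ (derive (⊓-elimˡ K K₂ YK K≡K₁⊓K₂)) ,
      derived⇒ext D K₂≡ (derive (⊓-elimʳ K K₁ YK K≡K₁⊓K₂))
    derived⇒ext (ex r C) {K} K≡ YK with ex-index K≡
    ... | K′ , K′≡ , K≡∃rK′ = K′ , derived⇒ext C K′≡ (derive ⊑-refl) , K , K≡∃rK′ , YK

    canonical-model : canonical isModelOf O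
    canonical-model α α∈O Y y∈lhs with axioms-closed α∈O
    ... | lhs∈U , rhs∈U with index-of lhs∈U | index-of rhs∈U
    ...   | L , L≡ | R , R≡ =
      derived⇒ext (rhs α) R≡ (derive (axiom L (ext⇒derived (lhs α) L≡ y∈lhs) α∈O L≡ R≡))

    underivable⇒not-entailed : ∀ {Z} → ¬ Derived s X₀ Z → ¬ O ⊨ (u X₀ ⊑ u Z)
    underivable⇒not-entailed {Z} ¬X₀Z O⊨X₀⊑Z =
      ¬X₀Z (ext⇒derived (u Z) refl (O⊨X₀⊑Z canonical canonical-model X₀ X₀∈X₀))
      where
      X₀∈X₀ : ext canonical (u X₀) X₀
      X₀∈X₀ = derived⇒ext (u X₀) refl (derive ⊑-refl)

  entails? : ∀ X Z → Dec (O ⊨ (u X ⊑ u Z))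
  entails? X Z with saturation
  ... | s , sound , closed with derived? s X Z
  ...   | yes XZ = yes (sound XZ)
  ...   | no ¬XZ = no (Canonical.underivable⇒not-entailed s closed X ¬XZ)

  ⊨? : ∀ {C D} → C ∈ U → D ∈ U → Dec (O ⊨ (C ⊑ D))
  ⊨? C∈U D∈U with index-of C∈U | index-of D∈U
  ... | X , refl | Z , refl = entails? X Z

mutual
  subconcepts : Concept → List Concept
  subconcepts C = C ∷ properSubconcepts C

  properSubconcepts : Concept → List Concept
  properSubconcepts (atom _) = []
  properSubconcepts top      = []
  properSubconcepts (C ⊓ D)  = subconcepts C ++ subconcepts D
  properSubconcepts (ex _ C) = subconcepts C

subconcepts-trans : ∀ E {C} → C ∈ subconcepts E → subconcepts C ⊆ subconcepts E
subconcepts-trans E        (here refl) = id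
subconcepts-trans (D ⊓ D′) (there C∈) with ∈-++⁻ (subconcepts D) C∈
... | inj₁ C∈D  = there ∘ ∈-++⁺ˡ ∘ subconcepts-trans D C∈D
... | inj₂ C∈D′ = there ∘ ∈-++⁺ʳ (subconcepts D) ∘ subconcepts-trans D′ C∈D′
subconcepts-trans (ex r D) (there C∈) = there ∘ subconcepts-trans D C∈
subconcepts-trans (atom _) (there ())
subconcepts-trans top      (there ())

subconceptsOf : List Concept → List Concept
subconceptsOf = concatMap subconcepts

∈-subconceptsOf : ∀ {C Cs} → C ∈ Cs → C ∈ subconceptsOf Cs
∈-subconceptsOf {Cs = Cs} = ∈-concatMap⁺ subconcepts {xs = Cs} ∘ Any.map λ { refl → here refl }

subconceptsOf-closed : ∀ {C D} Cs → C ∈ subconceptsOf Cs → D ∈ subconcepts C →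
                       D ∈ subconceptsOf Cs
subconceptsOf-closed Cs C∈ D∈C =
  ∈-concatMap⁺ subconcepts {xs = Cs}
    (Any.map (λ C∈E → subconcepts-trans _ C∈E D∈C) (∈-concatMap⁻ subconcepts {xs = Cs} C∈))

sides : GCI → List Concept
sides α = lhs α ∷ [ rhs α ]

⊨? : ∀ O α → Dec (O ⊨ α)
⊨? O (C ⊑ D) = Completion.⊨? O U ⊓-closed ex-closed axioms-closed
  (∈-subconceptsOf {Cs = Cs} (here refl)) (∈-subconceptsOf {Cs = Cs} (there (here refl)))
  where
  Cs : List Concept
  Cs = C ∷ D ∷ concatMap sides O

  U : List Concept
  U = subconceptsOf Cs

  ⊓-closed : ∀ {C D} → C ⊓ D ∈ U → C ∈ U × D ∈ U
  ⊓-closed {C} {D} C⊓D∈U =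
    subconceptsOf-closed Cs C⊓D∈U (there (∈-++⁺ˡ {ys = subconcepts D} (here refl))) ,
    subconceptsOf-closed Cs C⊓D∈U (there (∈-++⁺ʳ (subconcepts C) (here refl)))

  ex-closed : ∀ {r C} → ex r C ∈ U → C ∈ U
  ex-closed ∃rC∈U = subconceptsOf-closed Cs ∃rC∈U (there (here refl))

  axioms-closed : ∀ {α} → α ∈ O → lhs α ∈ U × rhs α ∈ U
  axioms-closed α∈O =
    ∈-subconceptsOf {Cs = Cs} (side∈Cs (here refl)) , ∈-subconceptsOf {Cs = Cs} (side∈Cs (there (here refl)))
    where
    side∈Cs : ∀ {E} → E ∈ sides _ → E ∈ Cs
    side∈Cs = there ∘ there ∘ ∈-concatMap⁺ sides {xs = O} ∘ lose α∈O

-- The one-step relation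

≻sub? : ∀ β γ → Dec (β ≻sub γ)
≻sub? β γ = lhs γ ≟ lhs β ×-dec ⊨? [] (rhs β ⊑ rhs γ) ×-dec ¬? (⊨? ((lhs β ⊑ rhs γ) ∷ []) β)

≻sub-respʳ : ∀ {β C E F} → β ≻sub (C ⊑ E) → E ≡∅ F → β ≻sub (C ⊑ F)
≻sub-respʳ {C ⊑ D} {E = E} {F} (refl , D⊑E , ⊭β) (E⊑F , _) =
  refl , ⊑∅-trans {D} {E} {F} D⊑E E⊑F , ⊭β ∘ ⊨-strengthen-axiom (C ⊑ D) E⊑F

≻sub-respˡ : ∀ {C E F γ} → (C ⊑ E) ≻sub γ → E ≡∅ F → (C ⊑ F) ≻sub γ
≻sub-respˡ {C} {E} {F} {_ ⊑ G} (refl , E⊑G , ⊭C⊑E) (_ , F⊑E) =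
  refl , ⊑∅-trans {F} {E} {G} F⊑E E⊑G ,
  λ ⊨C⊑F → ⊭C⊑E (⊨-⊑∅-trans {C = C} {F} {E} ⊨C⊑F F⊑E)

≻sub₁-respʳ : ∀ {β C E F} → β ≻sub₁ (C ⊑ E) → E ≡∅ F → β ≻sub₁ (C ⊑ F)
≻sub₁-respʳ {β} {C} {E} {F} (β≻γ , nothing-between) E≡F =
  ≻sub-respʳ {β} {C} {E} {F} β≻γ E≡F ,
  λ (δ , β≻δ , δ≻C⊑F) →
    nothing-between (δ , β≻δ , ≻sub-respʳ {δ} {C} {F} {E} δ≻C⊑F (≡∅-sym {E} {F} E≡F))

Between : GCI → GCI → Set₁
Between β γ = Σ GCI λ δ → β ≻sub δ × δ ≻sub γ

between⇒subsumer-between : ∀ {β γ} → Between β γ →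
  Any (λ F → β ≻sub (lhs β ⊑ F) × (lhs β ⊑ F) ≻sub γ) (subsumers (rhs β))
between⇒subsumer-between {C ⊑ D} {γ} ((_ ⊑ E) , β≻δ@(refl , D⊑E , _) , δ≻γ)
  with subsumers-complete D E D⊑E
... | F , F∈ , E≡F =
  lose F∈ (≻sub-respʳ {C ⊑ D} {C} {E} {F} β≻δ E≡F , ≻sub-respˡ {C} {E} {F} {γ} δ≻γ E≡F)

between? : ∀ β γ → Dec (Between β γ)
between? β γ =
  map′ (λ F-between → let F , β≻F≻γ = satisfied F-between in (lhs β ⊑ F) , β≻F≻γ)
       (between⇒subsumer-between {β} {γ})
       (Any.any? (λ F → ≻sub? β (lhs β ⊑ F) ×-dec ≻sub? (lhs β ⊑ F) γ) (subsumers (rhs β)))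

≻sub₁? : ∀ β γ → Dec (β ≻sub₁ γ)
≻sub₁? β γ = ≻sub? β γ ×-dec ¬? (between? β γ)

oneStepSuccessors : GCI → List GCI
oneStepSuccessors β = filter (≻sub₁? β) (map (lhs β ⊑_) (subsumers (rhs β)))

oneStepSuccessors-sound : ∀ β γ → γ ∈ oneStepSuccessors β → β ≻sub₁ γ
oneStepSuccessors-sound β γ =
  proj₂ ∘ ∈-filter⁻ (≻sub₁? β) {xs = map (lhs β ⊑_) (subsumers (rhs β))}

oneStepSuccessors-complete : ∀ β γ → β ≻sub₁ γ →
                             Σ GCI λ γ′ → γ′ ∈ oneStepSuccessors β × rhs γ ≡∅ rhs γ′
oneStepSuccessors-complete (C ⊑ D) (_ ⊑ E) β≻₁γ@((refl , D⊑E , _) , _)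
  with subsumers-complete D E D⊑E
... | F , F∈ , E≡F =
  (C ⊑ F) ,
  ∈-filter⁺ (≻sub₁? (C ⊑ D)) (∈-map⁺ (C ⊑_) F∈) (≻sub₁-respʳ {C ⊑ D} {C} {E} {F} β≻₁γ E≡F) ,
  E≡F

proposition25 : Σ (GCI → List GCI) λ succs →
    ∀ β → (∀ γ → γ ∈ succs β → β ≻sub₁ γ)
        × (∀ γ → β ≻sub₁ γ → Σ GCI (λ γ' → (γ' ∈ succs β) × (rhs γ ≡∅ rhs γ')))
proposition25 = oneStepSuccessors , λ β → oneStepSuccessors-sound β , oneStepSuccessors-complete β
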